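{- Let $G=([n],E(G))$ be a finite undirected graph and $k\in\mathbb{N}$. The algorithm described in the context, which decides whether $G$ is $k$-copwin, runs in time $O(kn^{k+2})$.
   Context: Cops and Robbers: first each of $k$ cops chooses a starting vertex of $G$, then the robber chooses one; then the cops and the robber alternate turns, starting with the cops. On the cops' turn each cop moves to a vertex at distance at most $1$; on the robber's turn the robber moves to a vertex at distance at most $1$. Several cops may share a vertex. The cops win if at some point a cop is on the robber's vertex; otherwise the robber wins. $G$ is $k$-copwin if the $k$ cops have a winning strategy. Algorithm: If $k\ge n$, output true. Otherwise let $S=[n]^{k+1}\times\mathbb{Z}_{k+1}$, where $(p_0,\dots,p_k,t)$ means the robber is at $p_0$, cop $i$ at $p_i$, and piece $t$ moved last (piece $0$ = robber), the cops being thought of as moving one at a time in order $1,\dots,k$ followed by the robber. Let $H$ be the directed graph on $S$ with an arc $((p_0,\dots,p_k,t),(p_0',\dots,p_k',t'))$ iff $t'=(t+1)\bmod(k+1)$, ($\{p_{t'},p_{t'}'\}\in E(G)$ or $p_{t'}=p_{t'}'$), and $p_i=p_i'$ for all $i\ne t'$; let $I(s)$ be the set of in-neighbours of $s$ in $H$. Initialize a boolean array $\mathrm{COPSWIN}$ on $S$ to $0$, an integer array $\mathrm{COUNTER}$ on states $(p_0,\dots,p_k,k)$ initialized to $1+\deg_G(p_0)$, and an empty queue. Enqueue and mark ($\mathrm{COPSWIN}=1$) every state with $p_0=p_i$ for some $i\in[k]$. While the queue is nonempty, dequeue $s=(p_0,\dots,p_k,t)$: if $t\ne0$, enqueue and mark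 every unmarked $q\in I(s)$; if $t=0$, for each $q\in I(s)$ decrement $\mathrm{COUNTER}(q)$ and, if it becomes $0$ and $q$ is unmarked, enqueue and mark $q$. Finally output true iff there is $(p_1,\dots,p_k)\in[n]^k$ with $\mathrm{COPSWIN}((p_0,p_1,\dots,p_k,0))=1$ for all $p_0\in[n]$, and false otherwise. Time is measured in elementary operations (the graph is given by adjacency lists). -}

module Defs where

open import Data.Nat.Base using (ℕ; zero; suc; _+_; _*_; _∸_; _^_; _<_; _≡ᵇ_; _≤ᵇ_; _/_; _%_)
open import Data.Bool.Base using (Bool; true; false; if_then_else_; _∧_; not)
open import Data.List.Base using (List; []; _∷_; _++_; map; foldl; upTo; length)
open import Data.Bool.ListAction using (any; all)
open import Data.Nat.ListAction using (sum)
open import Data.List.Membership.Propositional using (_∈_; _∉_)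
open import Data.List.Relation.Unary.Unique.Propositional using (Unique)
open import Data.Product.Base using (_×_; _,_)

record Graph (n : ℕ) : Set where
  field
    adj        : ℕ → List ℕ
    adj-bound  : ∀ u v → v ∈ adj u → v < n
    adj-sym    : ∀ u v → v ∈ adj u → u ∈ adj v
    adj-unique : ∀ u → Unique (adj u)
    adj-irrefl : ∀ u → u ∉ adj u

-- Total division / remainder (0 when the divisor is 0); one elementary op each.

quot : ℕ → ℕ → ℕ
quot a zero    = 0
quot a (suc b) = a / suc b

rem : ℕ → ℕ → ℕ
rem a zero    = a
rem a (suc b) = a % suc b

-- Functional model of a random-access array; a write is one elementary op.
set : {A : Set} → (ℕ → A) → ℕ → A → (ℕ → A)
set a i x j = if j ≡ᵇ i then x else a j

-- A state (p₀,…,p_k,t) ∈ [n]^{k+1} × ℤ_{k+1} is encoded by the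
-- number  t·n^{k+1} + Σᵢ pᵢ·nⁱ  (< (k+1)·n^{k+1}).  Arithmetic on such
-- numbers, array reads/writes, queue operations and comparisons each count
-- as O(1) elementary operations (unit-cost RAM); the powers nⁱ (i ≤ k+1)
-- are charged as precomputed once.

module Algorithm (n k : ℕ) (adj : ℕ → List ℕ) where

  N : ℕ
  N = n ^ suc k

  total : ℕ
  total = suc k * N

  pw : ℕ → ℕ
  pw i = n ^ i

  coord : ℕ → ℕ → ℕ
  coord s i = rem (quot (rem s N) (pw i)) n

  turn : ℕ → ℕ
  turn s = quot s N

  setCoord : ℕ → ℕ → ℕ → ℕ
  setCoord s i v = (s ∸ coord s i * pw i) + v * pw i

  setTurn : ℕ → ℕ → ℕ
  setTurn s t = rem s N + t * N

  prevTurn : ℕ → ℕ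
  prevTurn t = rem (t + k) (suc k)

  -- I(s): in-neighbours of s in H (piece t' = turn s moved last into s;
  -- predecessor has turn t'-1 and p_{t'} replaced by a closed neighbour).
  preds : ℕ → List ℕ
  preds s = map (λ w → setTurn (setCoord s (turn s) w) (prevTurn (turn s)))
                (coord s (turn s) ∷ adj (coord s (turn s)))

  record St : Set where
    constructor st
    field
      win   : ℕ → Bool
      cnt   : ℕ → ℕ
      queue : List ℕ
      cost  : ℕ

  stepT : St → ℕ → St
  stepT (st w c qu x) q =
    if w q then st w c qu (suc x)
           else st (set w q true) c (qu ++ q ∷ []) (suc (suc x))

  step0 : St → ℕ → St
  step0 (st w c qu x) q =
    if ((c q ∸ 1) ≡ᵇ 0) ∧ not (w q)
      then st (set w q true) (set c q (c q ∸ 1)) (qu ++ q ∷ []) (x + 3)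
      else st w (set c q (c q ∸ 1)) qu (x + 2)

  -- main loop; the fuel (|S| + 1) is never exhausted since every state is
  -- enqueued at most once (it is marked when enqueued).
  loop : ℕ → St → St
  loop zero    σ                 = σ
  loop (suc f) (st w c [] x)     = st w c [] (suc x)
  loop (suc f) (st w c (s ∷ qu) x) =
    loop f (foldl (if turn s ≡ᵇ 0 then step0 else stepT) (st w c qu (x + 5)) (preds s))

  initMark : St → ℕ → St
  initMark (st w c qu x) s =
    if any (λ i → coord s i ≡ᵇ coord s 0) (map suc (upTo k))
      then st (set w s true) c (qu ++ s ∷ []) (x + suc k + 1)
      else st w c qu (x + suc k)

  -- cost of initialising COUNTER (degree computed from the adjacency list)
  counterCost : ℕ
  counterCost = sum (map (λ s → suc (if turn s ≡ᵇ k then suc (length (adj (coord s 0))) else 0))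
                         (upTo total))

  initial : St
  initial = st (λ _ → false) (λ s → suc (length (adj (coord s 0)))) []
               (suc (suc k) + total + counterCost)

  final : St
  final = loop (suc total) (foldl initMark initial (upTo total))

  -- answer: some cop position (p₁,…,p_k) (encoded as c < n^k) wins against
  -- every robber position p₀ with the cops to move (t = 0)
  answer : Bool
  answer = any (λ c → all (λ p₀ → St.win final (p₀ + n * c)) (upTo n)) (upTo (n ^ k))

  runCost : ℕ
  runCost = St.cost final + n ^ k * suc n

copwinAlgorithm : (n k : ℕ) → Graph n → Bool × ℕ
copwinAlgorithm n k G =
  if n ≤ᵇ k then (true , 1)
  else (Algorithm.answer n k (Graph.adj G) , Algorithm.runCost n k (Graph.adj G))

-- The main loop runs at most |S| + 1 iterations, and one iteration costs O(1)
-- plus O(1) per in-neighbour of the dequeued state; there are at most n + 1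
-- of those, since adjacency lists are duplicate-free lists of vertices.  So
-- the loop costs O(|S| n) = O(k n^{k+2}).  The marking (O(k |S|)), the COUNTER
-- initialisation (O(|S| n)) and the final scan (O(n^{k+1})) fit within the
-- same bound because k < n whenever the algorithm does not answer at once.

module Submission where

open import Defs
open import Data.Nat.Base
open import Data.Nat.Properties
open import Data.Nat.ListAction using (sum)
open import Data.Nat.Tactic.RingSolver using (solve-∀)
open import Data.Bool.Base using (true; false; T; if_then_else_; _∧_; not)
open import Data.Bool.ListAction using (any)
open import Data.List.Base using (List; []; _∷_; map; foldl; upTo; length)
open import Data.List.Properties using (length-map; length-upTo)
open import Data.List.Membership.Propositional using (_∈_)
open import Data.List.Membership.Propositional.Properties using (∈-upTo⁺)
open import Data.List.Relation.Binary.Subset.Propositional using (_⊆_)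
open import Data.List.Relation.Unary.Any using (here; there)
open import Data.List.Relation.Unary.AllPairs using ([]; _∷_)
open import Data.List.Relation.Unary.Unique.Propositional using (Unique)
open import Data.List.Relation.Unary.Unique.Propositional.Properties using (upTo⁺)
open import Data.List.Fresh as Fresh using (fromList)
open import Data.List.Fresh.Relation.Unary.Any as FreshAny using ()
open import Data.Product.Base using (proj₂; ∃-syntax; _,_)
open import Function.Base using (id; _∘_)
open import Relation.Binary.PropositionalEquality
  using (_≡_; refl; cong; trans; subst; subst₂; setoid)

module _ {a} {A : Set a} where
  open import Data.List.Fresh.Membership.Setoid (setoid A) renaming (_∈_ to _∈#_)
  open import Data.List.Fresh.Membership.Setoid.Properties (setoid A) using (injection)

  length-fromList : ∀ {xs : List A} (u : Unique xs) → Fresh.length (fromList u) ≡ length xs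
  length-fromList []      = refl
  length-fromList (_ ∷ u) = cong suc (length-fromList u)

  ∈-fromList⁺ : ∀ {x xs} (u : Unique xs) → x ∈ xs → x ∈# fromList u
  ∈-fromList⁺ (_ ∷ u) (here x≡y) = FreshAny.here x≡y
  ∈-fromList⁺ (_ ∷ u) (there x∈) = FreshAny.there (∈-fromList⁺ u x∈)

  ∈-fromList⁻ : ∀ {x xs} (u : Unique xs) → x ∈# fromList u → x ∈ xs
  ∈-fromList⁻ (_ ∷ u) (FreshAny.here x≡y) = here x≡y
  ∈-fromList⁻ (_ ∷ u) (FreshAny.there x∈) = there (∈-fromList⁻ u x∈)

  Unique-⊆⇒length≤ : ∀ {xs ys : List A} → Unique xs → Unique ys → xs ⊆ ys →
                     length xs ≤ length ys
  Unique-⊆⇒length≤ uxs uys xs⊆ys =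
    subst₂ _≤_ (length-fromList uxs) (length-fromList uys)
      (injection id (∈-fromList⁺ uys ∘ xs⊆ys ∘ ∈-fromList⁻ uxs))

degree≤ : ∀ {n} (G : Graph n) u → length (Graph.adj G u) ≤ n
degree≤ {n} G u = subst (length (Graph.adj G u) ≤_) (length-upTo n)
  (Unique-⊆⇒length≤ (Graph.adj-unique G u) (upTo⁺ n) (∈-upTo⁺ ∘ Graph.adj-bound G u _))

foldl-cost≤ : ∀ {S A : Set} (cost : S → ℕ) (f : S → A → S) b →
              (∀ σ x → cost (f σ x) ≤ cost σ + b) →
              ∀ σ xs → cost (foldl f σ xs) ≤ cost σ + length xs * b
foldl-cost≤ cost f b f≤ σ []       = m≤m+n (cost σ) 0
foldl-cost≤ cost f b f≤ σ (x ∷ xs) = begin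
  cost (foldl f (f σ x) xs)    ≤⟨ foldl-cost≤ cost f b f≤ (f σ x) xs ⟩
  cost (f σ x) + length xs * b ≤⟨ +-monoˡ-≤ _ (f≤ σ x) ⟩
  cost σ + b + length xs * b   ≡⟨ +-assoc (cost σ) b _ ⟩
  cost σ + (b + length xs * b) ∎
  where open ≤-Reasoning

sum-map≤ : ∀ {A : Set} (f : A → ℕ) b → (∀ x → f x ≤ b) → ∀ xs → sum (map f xs) ≤ length xs * b
sum-map≤ f b f≤ []       = z≤n
sum-map≤ f b f≤ (x ∷ xs) = +-mono-≤ (f≤ x) (sum-map≤ f b f≤ xs)

-- Operation count of the whole run with S states, where d bounds the cost of
-- one marking test (k + 2) and q the number n^k of cop positions scanned.
costPolynomial : (n d S q : ℕ) → ℕ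
costPolynomial n d S q =
  d + S + S * suc (suc n) + S * d + suc S * (5 + suc n * 3) + q * suc n

costPolynomial-mono : ∀ n S {d d′ q q′} → d ≤ d′ → q ≤ q′ →
                      costPolynomial n d S q ≤ costPolynomial n d′ S q′
costPolynomial-mono n S d≤d′ q≤q′ =
  +-mono-≤ (+-monoˡ-≤ _ (+-mono-≤ (+-monoˡ-≤ _ (+-monoˡ-≤ _ d≤d′)) (*-monoʳ-≤ S d≤d′)))
           (*-monoˡ-≤ (suc n) q≤q′)

-- The identity exhibits the difference as a polynomial with natural coefficients.
costPolynomial≤ : ∀ m {d S q} → d ≤ suc (suc m) → q ≤ S → 1 ≤ S →
                  costPolynomial (suc m) d S q ≤ 32 * (S * suc m)
costPolynomial≤ m {d} {S = suc t} {q} d≤ q≤S _ = begin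
  costPolynomial n d S q                     ≤⟨ costPolynomial-mono n S d≤ q≤S ⟩
  costPolynomial n (suc n) S S               ≤⟨ m≤m+n _ _ ⟩
  costPolynomial n (suc n) S S + (26 * t * m + 13 * t + 22 * m)
                                             ≡⟨ identity m t ⟩
  32 * (S * n)                               ∎
  where
  open ≤-Reasoning
  n = suc m
  S = suc t
  identity : ∀ m t → suc (suc m) + suc t + suc t * suc (suc (suc m)) + suc t * suc (suc m)
                       + suc (suc t) * (5 + suc (suc m) * 3) + suc t * suc (suc m)
                       + (26 * t * m + 13 * t + 22 * m) ≡ 32 * (suc t * suc m)
  identity = solve-∀

module Cost (n k : ℕ) (adj : ℕ → List ℕ) (degree≤n : ∀ u → length (adj u) ≤ n) where
  open Algorithm n k adj

  handle : ℕ → St → ℕ → St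
  handle s = if turn s ≡ᵇ 0 then step0 else stepT

  handle-cost : ∀ s σ q → St.cost (handle s σ q) ≤ St.cost σ + 3
  handle-cost s (st w c qu x) q with turn s ≡ᵇ 0
  ... | true with ((c q ∸ 1) ≡ᵇ 0) ∧ not (w q)
  ...   | true  = ≤-refl
  ...   | false = +-monoʳ-≤ x (n≤1+n 2)
  handle-cost s (st w c qu x) q | false with w q
  ...   | true  = m<m+n x z<s
  ...   | false = ≤-trans (≤-reflexive (+-comm 2 x)) (+-monoʳ-≤ x (n≤1+n 2))

  length-preds≤ : ∀ s → length (preds s) ≤ suc n
  length-preds≤ s = ≤-trans (≤-reflexive (length-map _ (coord s (turn s) ∷ adj (coord s (turn s)))))
                            (s≤s (degree≤n _))

  dequeueCost : ℕ
  dequeueCost = 5 + suc n * 3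

  loop-cost≤ : ∀ f σ → St.cost (loop f σ) ≤ St.cost σ + f * dequeueCost
  loop-cost≤ zero    σ                   = m≤m+n _ 0
  loop-cost≤ (suc f) (st w c [] x)       = m<m+n x z<s
  loop-cost≤ (suc f) (st w c (s ∷ qu) x) = begin
    St.cost (loop f σ′)                      ≤⟨ loop-cost≤ f σ′ ⟩
    St.cost σ′ + f * dequeueCost             ≤⟨ +-monoˡ-≤ _ (foldl-cost≤ St.cost (handle s) 3 (handle-cost s) _ (preds s)) ⟩
    x + 5 + length (preds s) * 3 + f * dequeueCost
                                             ≤⟨ +-monoˡ-≤ _ (+-monoʳ-≤ (x + 5) (*-monoˡ-≤ 3 (length-preds≤ s))) ⟩
    x + 5 + suc n * 3 + f * dequeueCost      ≡⟨ cong (_+ f * dequeueCost) (+-assoc x 5 _) ⟩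
    x + dequeueCost + f * dequeueCost        ≡⟨ +-assoc x dequeueCost _ ⟩
    x + (dequeueCost + f * dequeueCost)      ∎
    where
    open ≤-Reasoning
    σ′ = foldl (handle s) (st w c qu (x + 5)) (preds s)

  initMark-cost : ∀ σ s → St.cost (initMark σ s) ≤ St.cost σ + suc (suc k)
  initMark-cost (st w c qu x) s with any (λ i → coord s i ≡ᵇ coord s 0) (map suc (upTo k))
  ... | true  = ≤-reflexive (trans (+-assoc x (suc k) 1) (cong (x +_) (+-comm (suc k) 1)))
  ... | false = +-monoʳ-≤ x (n≤1+n (suc k))

  counterCost≤ : counterCost ≤ total * suc (suc n)
  counterCost≤ = subst (λ l → counterCost ≤ l * suc (suc n)) (length-upTo total)
    (sum-map≤ _ (suc (suc n)) counterTerm≤ (upTo total))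
    where
    counterTerm≤ : ∀ s → suc (if turn s ≡ᵇ k then suc (length (adj (coord s 0))) else 0) ≤ suc (suc n)
    counterTerm≤ s with turn s ≡ᵇ k
    ... | true  = s≤s (s≤s (degree≤n _))
    ... | false = s≤s z≤n

  runCost≤costPolynomial : runCost ≤ costPolynomial n (suc (suc k)) total (n ^ k)
  runCost≤costPolynomial = +-monoˡ-≤ (n ^ k * suc n) (begin
    St.cost final                                    ≤⟨ loop-cost≤ (suc total) marked ⟩
    St.cost marked + suc total * dequeueCost         ≤⟨ +-monoˡ-≤ _ (foldl-cost≤ St.cost initMark _ initMark-cost initial (upTo total)) ⟩
    St.cost initial + length (upTo total) * suc (suc k) + suc total * dequeueCost
                                                     ≡⟨ cong (λ l → St.cost initial + l * suc (suc k) + suc total * dequeueCost) (length-upTo total) ⟩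
    St.cost initial + total * suc (suc k) + suc total * dequeueCost
                                                     ≤⟨ +-monoˡ-≤ _ (+-monoˡ-≤ _ (+-monoʳ-≤ (suc (suc k) + total) counterCost≤)) ⟩
    suc (suc k) + total + total * suc (suc n) + total * suc (suc k) + suc total * dequeueCost ∎)
    where
    open ≤-Reasoning
    marked = foldl initMark initial (upTo total)

runCost≤ : ∀ {n k} (G : Graph n) → k < n →
           Algorithm.runCost n k (Graph.adj G) ≤ 32 * suc k * n ^ (k + 2)
runCost≤ {n@(suc m)} {k} G (s≤s k≤m) = begin
  runCost                                      ≤⟨ Cost.runCost≤costPolynomial n k (Graph.adj G) (degree≤ G) ⟩
  costPolynomial n (suc (suc k)) total (n ^ k) ≤⟨ costPolynomial≤ m (s≤s (s≤s k≤m)) n^k≤total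
                                                    (≤-trans (m^n>0 n k) n^k≤total) ⟩
  32 * (total * n)                             ≡⟨ reassociate n (suc k) (n ^ k) ⟩
  32 * suc k * n ^ (2 + k)                     ≡⟨ cong (λ e → 32 * suc k * n ^ e) (+-comm 2 k) ⟩
  32 * suc k * n ^ (k + 2)                     ∎
  where
  open ≤-Reasoning
  open Algorithm n k (Graph.adj G)
  n^k≤total : n ^ k ≤ total
  n^k≤total = ≤-trans (m≤n*m (n ^ k) n) (m≤n*m (n * n ^ k) (suc k))
  reassociate : ∀ n a p → 32 * (a * (n * p) * n) ≡ 32 * a * (n * (n * p))
  reassociate = solve-∀

copwinAlgorithm-cost≤ : ∀ n k (G : Graph n) →
                        proj₂ (copwinAlgorithm n k G) ≤ 32 * suc k * n ^ (k + 2) + 32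
copwinAlgorithm-cost≤ n k G with n ≤ᵇ k in n≤ᵇk
... | true  = ≤-trans (s≤s z≤n) (m≤n+m 32 _)
... | false = ≤-trans (runCost≤ G k<n) (m≤m+n _ 32)
  where
  k<n : k < n
  k<n = ≰⇒> (λ n≤k → subst T n≤ᵇk (≤⇒≤ᵇ n≤k))

corollary4 : ∃[ c ] ((n k : ℕ) (G : Graph n) →
               proj₂ (copwinAlgorithm n k G) ≤ c * suc k * n ^ (k + 2) + c)
corollary4 = 32 , copwinAlgorithm-cost≤
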